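{- Let $w\in W_{n,r}$, let $S=\{e_1,\dots,e_n\}$ be linearly ordered by $e_1<\dots<e_n$, and let $M=M_w$. Then the image of $\lambda_M\colon \mathfrak{S}_n\to W_{n,r}$ is the principal order ideal $\{v\in W_{n,r} : v\le w\}$.
   Context: $W_{n,r}$ is the set of words of length $n$ on $\{0,1\}$ with exactly $r$ ones; for $w\in W_{n,r}$ and $1\le k\le r$, $\pi_k(w)$ is the position of the $k$-th $1$ in $w$; $W_{n,r}$ is partially ordered by $v\le w$ iff $\pi_k(v)\le\pi_k(w)$ for all $k$. $M_w$ is the matroid on $S$ whose independent sets are the $I\subseteq S$ with $|I\cap S_i|\le i$ for $0\le i\le r$, where $S_r=S$ and $S_{k-1}=\{e_1,\dots,e_{\pi_k(w)-1}\}$ for $1\le k\le r$. For a matroid $M$ on a linearly ordered set $\{f_1<\dots<f_n\}$ with closure operator $\mathrm{cl}$, its distinguished word is $x_1\cdots x_n$ with $x_i=0$ if $f_i\in\mathrm{cl}\{f_1,\dots,f_{i-1}\}$ and $x_i=1$ otherwise. The symmetric group $\mathfrak{S}_n$ acts on $S$ by $\sigma(e_i)=e_{\sigma(i)}$; $S_\sigma$ denotes $S$ with the linear order $\sigma(e_1)<\dots<\sigma(e_n)$, and $\lambda_M(\sigma)$ is the distinguished word of $M$ on $S_\sigma$. -}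

module Defs where

open import Data.Bool using (Bool; true; false)
open import Data.Nat using (ℕ; zero; suc; _≤_; _<ᵇ_)
open import Data.Fin using (Fin; toℕ)
open import Data.Fin.Subset using (Subset; _∈_; _⊆_; _∩_; _∪_; ⁅_⁆; ∣_∣)
open import Data.Fin.Permutation using (Permutation′; _⟨$⟩ʳ_; _⟨$⟩ˡ_)
open import Data.Vec using (Vec; []; _∷_; lookup; tabulate)
open import Data.List using (List; []; _∷_; length; map)
import Data.List as List
open import Data.List.Relation.Binary.Pointwise using (Pointwise)
open import Data.Product using (Σ; _×_; ∃)
open import Relation.Binary.PropositionalEquality using (_≡_)
open import Relation.Nullary using (¬_)

-- Words of length n on {0,1}: true = 1, false = 0.
Word : ℕ → Set
Word n = Vec Bool n

-- Positions (1-indexed) of the ones of a word, in increasing order: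
-- the k-th entry (k = 1..r) is π_k(w).
onesFrom : ∀ {n} → ℕ → Word n → List ℕ
onesFrom p []            = []
onesFrom p (true  ∷ xs)  = suc p ∷ onesFrom (suc p) xs
onesFrom p (false ∷ xs)  = onesFrom (suc p) xs

ones : ∀ {n} → Word n → List ℕ
ones = onesFrom 0

numOnes : ∀ {n} → Word n → ℕ
numOnes w = length (ones w)

InW : (n r : ℕ) → Word n → Set
InW n r w = numOnes w ≡ r

_≤W_ : ∀ {n} → Word n → Word n → Set
v ≤W w = Pointwise _≤_ (ones v) (ones w)

-- The initial segment {e_1, ..., e_{p-1}} (element j : Fin n is e_{toℕ j + 1}).
initSeg : ∀ {n} → ℕ → Subset n
initSeg p = tabulate (λ j → suc (toℕ j) <ᵇ p)

-- Independent sets of M_w (with parameter r):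
-- |I ∩ S_r| = |I| ≤ r, and for k = 1..r, |I ∩ S_{k-1}| ≤ k-1,
-- where S_{k-1} = {e_1,...,e_{π_k(w)-1}}.
IndepMw : ∀ {n} → (r : ℕ) → Word n → Subset n → Set
IndepMw r w I =
  (∣ I ∣ ≤ r) ×
  (∀ (k : Fin (length (ones w))) →
     ∣ I ∩ initSeg (List.lookup (ones w) k) ∣ ≤ toℕ k)

IsRank : ∀ {n} → (Subset n → Set) → Subset n → ℕ → Set
IsRank Ind X ρ =
  (Σ (Subset _) λ I → I ⊆ X × Ind I × ∣ I ∣ ≡ ρ) ×
  (∀ I → I ⊆ X → Ind I → ∣ I ∣ ≤ ρ)

InClosure : ∀ {n} → (Subset n → Set) → Subset n → Fin n → Set
InClosure Ind X e = ∃ λ ρ → IsRank Ind X ρ × IsRank Ind (X ∪ ⁅ e ⁆) ρ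

-- In S_σ the i-th element is f_i = σ(e_i); {f_1,...,f_{i-1}} = {σ(e_j) : j < i}.
predSet : ∀ {n} → Permutation′ n → Fin n → Subset n
predSet σ i = tabulate (λ e → toℕ (σ ⟨$⟩ˡ e) <ᵇ toℕ i)

IsDistWord : ∀ {n} → (Subset n → Set) → Permutation′ n → Word n → Set
IsDistWord Ind σ v =
  ∀ i → (lookup v i ≡ false → InClosure Ind (predSet σ i) (σ ⟨$⟩ʳ i))
      × (InClosure Ind (predSet σ i) (σ ⟨$⟩ʳ i) → lookup v i ≡ false)

module Submission where

-- Independence in M_w is prefix domination: I is independent iff for every t it has at most
-- as many elements among e_1, ..., e_t as w has ones among its first t letters; and v ≤ w says
-- that w is dominated by v in the same sense, because π_k(v) ≤ t iff v has at least k ones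
-- among its first t letters. Along the chain {f_1, ..., f_t} of S_σ the rank increases exactly
-- where λ_M(σ) has a one, so the rank of {f_1, ..., f_t} is the number of ones among the first
-- t letters of λ_M(σ). As the last (ones of w up to t) elements of any t-set are independent,
-- λ_M(σ) ≤ w. Conversely, for v ≤ w let σ send the k-th one (zero) of v to the k-th one (zero)
-- of w: then {f_1, ..., f_t} consists of the first m ones and the first t - m zeros of w, where
-- m counts the ones of v up to t, and this set has rank m.

open import Defs
open import Data.Bool using (Bool; true; false)
open import Data.Bool.Properties using (T-≡)
open import Data.Fin using (Fin; toℕ; zero; suc; fromℕ<; cast)
open import Data.Fin.Permutation using (Permutation′; _⟨$⟩ʳ_; _⟨$⟩ˡ_; inverseˡ; inverseʳ)
open import Data.Fin.Properties using (all?; cast-involutive; toℕ<n; toℕ-cast; toℕ-fromℕ<; toℕ-injective)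
open import Data.Fin.Subset using (Subset; _∈_; _∉_; _⊆_; _∩_; _∪_; ⁅_⁆; ∣_∣; ⊥; ⊤; ∁)
open import Data.Fin.Subset.Properties
open import Data.List using (length)
import Data.List as List
open import Data.List.Relation.Binary.Pointwise using (lookup⁺; lookup⁻; Pointwise-length)
open import Data.Nat
open import Data.Nat.Properties
open import Data.Product using (Σ; ∃; _×_; _,_; proj₁)
open import Data.Sum as Sum using (_⊎_; inj₁; inj₂; [_,_]′)
open import Data.Sum.Function.Propositional using (_⊎-↔_)
open import Data.Vec using (Vec; []; _∷_; lookup; tabulate; here; there)
open import Data.Vec.Properties using (lookup∘tabulate; tabulate∘lookup; tabulate-cong; []=⇒lookup; lookup⇒[]=)
open import Function using (_∘_)
open import Function.Bundles using (_⇔_; mk⇔; Equivalence; _↔_; mk↔ₛ′)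
open import Function.Properties.Inverse using (↔-trans; ↔-sym)
open import Relation.Binary.PropositionalEquality hiding (J)
open import Relation.Nullary using (¬_; yes; no; contradiction)
open import Relation.Nullary.Decidable using (_×-dec_)
open import Relation.Unary using (Decidable)

open Equivalence using (to; from)
open ≤-Reasoning

private
  variable
    n r : ℕ
    u v w I J : Vec Bool n

onesUpTo : ℕ → Vec Bool n → ℕ
onesUpTo zero    _           = 0
onesUpTo (suc t) []          = 0
onesUpTo (suc t) (true  ∷ u) = suc (onesUpTo t u)
onesUpTo (suc t) (false ∷ u) = onesUpTo t u

onesUpTo-mono : ∀ {s t} (u : Vec Bool n) → s ≤ t → onesUpTo s u ≤ onesUpTo t u
onesUpTo-mono {s = zero}  u           _         = z≤n
onesUpTo-mono {s = suc s} []          _         = z≤n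
onesUpTo-mono {s = suc s} (true  ∷ u) (s≤s s≤t) = s≤s (onesUpTo-mono u s≤t)
onesUpTo-mono {s = suc s} (false ∷ u) (s≤s s≤t) = onesUpTo-mono u s≤t

onesUpTo≤ : ∀ t (u : Vec Bool n) → onesUpTo t u ≤ t
onesUpTo≤ zero    u           = z≤n
onesUpTo≤ (suc t) []          = z≤n
onesUpTo≤ (suc t) (true  ∷ u) = s≤s (onesUpTo≤ t u)
onesUpTo≤ (suc t) (false ∷ u) = m≤n⇒m≤1+n (onesUpTo≤ t u)

onesUpTo≤∣∣ : ∀ t (u : Vec Bool n) → onesUpTo t u ≤ ∣ u ∣
onesUpTo≤∣∣ zero    u           = z≤n
onesUpTo≤∣∣ (suc t) []          = z≤n
onesUpTo≤∣∣ (suc t) (true  ∷ u) = s≤s (onesUpTo≤∣∣ t u)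
onesUpTo≤∣∣ (suc t) (false ∷ u) = onesUpTo≤∣∣ t u

onesUpTo-full : ∀ {t} (u : Vec Bool n) → n ≤ t → onesUpTo t u ≡ ∣ u ∣
onesUpTo-full {t = zero}  []          _         = refl
onesUpTo-full {t = suc t} []          _         = refl
onesUpTo-full {t = suc t} (true  ∷ u) (s≤s n≤t) = cong suc (onesUpTo-full u n≤t)
onesUpTo-full {t = suc t} (false ∷ u) (s≤s n≤t) = onesUpTo-full u n≤t

onesUpTo-⊆ : ∀ t {I J : Subset n} → I ⊆ J → onesUpTo t I ≤ onesUpTo t J
onesUpTo-⊆ zero    _ = z≤n
onesUpTo-⊆ (suc t) {[]}        {[]}        _   = z≤n
onesUpTo-⊆ (suc t) {true  ∷ I} {true  ∷ J} I⊆J = s≤s (onesUpTo-⊆ t (drop-∷-⊆ I⊆J))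
onesUpTo-⊆ (suc t) {true  ∷ I} {false ∷ J} I⊆J with I⊆J here
... | ()
onesUpTo-⊆ (suc t) {false ∷ I} {true  ∷ J} I⊆J = m≤n⇒m≤1+n (onesUpTo-⊆ t (drop-∷-⊆ I⊆J))
onesUpTo-⊆ (suc t) {false ∷ I} {false ∷ J} I⊆J = onesUpTo-⊆ t (drop-∷-⊆ I⊆J)

onesUpTo-gap : ∀ s t (u : Vec Bool n) → onesUpTo t u ≤ onesUpTo s u + (t ∸ s)
onesUpTo-gap s       zero    u           = z≤n
onesUpTo-gap zero    (suc t) u           = onesUpTo≤ (suc t) u
onesUpTo-gap (suc s) (suc t) []          = z≤n
onesUpTo-gap (suc s) (suc t) (true  ∷ u) = s≤s (onesUpTo-gap s t u)
onesUpTo-gap (suc s) (suc t) (false ∷ u) = onesUpTo-gap s t u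

onesUpTo+onesUpTo∁ : ∀ {t} (u : Vec Bool n) → t ≤ n → onesUpTo t u + onesUpTo t (∁ u) ≡ t
onesUpTo+onesUpTo∁ {t = zero}  u           _         = refl
onesUpTo+onesUpTo∁ {t = suc t} (true  ∷ u) (s≤s t≤n) = cong suc (onesUpTo+onesUpTo∁ u t≤n)
onesUpTo+onesUpTo∁ {t = suc t} (false ∷ u) (s≤s t≤n) =
  trans (+-suc _ _) (cong suc (onesUpTo+onesUpTo∁ u t≤n))

onesUpTo-suc-true : (u : Vec Bool n) (i : Fin n) → lookup u i ≡ true →
                    onesUpTo (suc (toℕ i)) u ≡ suc (onesUpTo (toℕ i) u)
onesUpTo-suc-true (true  ∷ u) zero    refl = refl
onesUpTo-suc-true (true  ∷ u) (suc i) ui   = cong suc (onesUpTo-suc-true u i ui)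
onesUpTo-suc-true (false ∷ u) (suc i) ui   = onesUpTo-suc-true u i ui

onesUpTo-suc-false : (u : Vec Bool n) (i : Fin n) → lookup u i ≡ false →
                     onesUpTo (suc (toℕ i)) u ≡ onesUpTo (toℕ i) u
onesUpTo-suc-false (false ∷ u) zero    refl = refl
onesUpTo-suc-false (true  ∷ u) (suc i) ui   = cong suc (onesUpTo-suc-false u i ui)
onesUpTo-suc-false (false ∷ u) (suc i) ui   = onesUpTo-suc-false u i ui

_≼_ : Vec Bool n → Vec Bool n → Set
u ≼ w = ∀ t → onesUpTo t u ≤ onesUpTo t w

≼-upTo : ∀ {u w : Vec Bool n} → (∀ t → t ≤ n → onesUpTo t u ≤ onesUpTo t w) → u ≼ w
≼-upTo {n} {u} {w} dom t with t ≤? n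
... | yes t≤n = dom t t≤n
... | no  t≰n = subst₂ _≤_ (full u) (full w) (dom n ≤-refl)
  where
  full : ∀ x → onesUpTo n x ≡ onesUpTo t x
  full x = trans (onesUpTo-full x ≤-refl) (sym (onesUpTo-full x (<⇒≤ (≰⇒> t≰n))))

onesUpTo∁-antitone : ∀ {t} (u w : Vec Bool n) → t ≤ n →
                     onesUpTo t u ≤ onesUpTo t w → onesUpTo t (∁ w) ≤ onesUpTo t (∁ u)
onesUpTo∁-antitone {t = t} u w t≤n u≤w = +-cancelˡ-≤ (onesUpTo t u) _ _ (begin
  onesUpTo t u + onesUpTo t (∁ w)  ≤⟨ +-monoˡ-≤ _ u≤w ⟩
  onesUpTo t w + onesUpTo t (∁ w)  ≡⟨ onesUpTo+onesUpTo∁ w t≤n ⟩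
  t                                ≡⟨ sym (onesUpTo+onesUpTo∁ u t≤n) ⟩
  onesUpTo t u + onesUpTo t (∁ u)  ∎)

onesAfter : ℕ → Vec Bool n → ℕ
onesAfter zero    u       = ∣ u ∣
onesAfter (suc t) []      = 0
onesAfter (suc t) (_ ∷ u) = onesAfter t u

onesUpTo+onesAfter : ∀ t (u : Vec Bool n) → onesUpTo t u + onesAfter t u ≡ ∣ u ∣
onesUpTo+onesAfter zero    u           = refl
onesUpTo+onesAfter (suc t) []          = refl
onesUpTo+onesAfter (suc t) (true  ∷ u) = cong suc (onesUpTo+onesAfter t u)
onesUpTo+onesAfter (suc t) (false ∷ u) = onesUpTo+onesAfter t u

onesAfter-⊆ : ∀ t {I J : Subset n} → I ⊆ J → onesAfter t I ≤ onesAfter t J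
onesAfter-⊆ zero    I⊆J = p⊆q⇒∣p∣≤∣q∣ I⊆J
onesAfter-⊆ (suc t) {[]}    {[]}    _   = z≤n
onesAfter-⊆ (suc t) {_ ∷ I} {_ ∷ J} I⊆J = onesAfter-⊆ t (drop-∷-⊆ I⊆J)

∣∩initSeg0∣≡0 : (I : Subset n) → ∣ I ∩ initSeg 0 ∣ ≡ 0
∣∩initSeg0∣≡0 []          = refl
∣∩initSeg0∣≡0 (true  ∷ I) = ∣∩initSeg0∣≡0 I
∣∩initSeg0∣≡0 (false ∷ I) = ∣∩initSeg0∣≡0 I

∣∩initSeg∣≡onesUpTo : ∀ q (I : Subset n) → ∣ I ∩ initSeg q ∣ ≡ onesUpTo (pred q) I
∣∩initSeg∣≡onesUpTo zero          I           = ∣∩initSeg0∣≡0 I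
∣∩initSeg∣≡onesUpTo (suc zero)    I           = ∣∩initSeg0∣≡0 I
∣∩initSeg∣≡onesUpTo (suc (suc q)) []          = refl
∣∩initSeg∣≡onesUpTo (suc (suc q)) (true  ∷ I) = cong suc (∣∩initSeg∣≡onesUpTo (suc q) I)
∣∩initSeg∣≡onesUpTo (suc (suc q)) (false ∷ I) = ∣∩initSeg∣≡onesUpTo (suc q) I

length-onesFrom : ∀ p (u : Vec Bool n) → length (onesFrom p u) ≡ ∣ u ∣
length-onesFrom p []          = refl
length-onesFrom p (true  ∷ u) = cong suc (length-onesFrom (suc p) u)
length-onesFrom p (false ∷ u) = length-onesFrom (suc p) u

lookup-onesFrom> : ∀ p (u : Vec Bool n) k → p < List.lookup (onesFrom p u) k
lookup-onesFrom> p (true  ∷ u) zero    = n<1+n p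
lookup-onesFrom> p (true  ∷ u) (suc k) = <-trans (n<1+n p) (lookup-onesFrom> (suc p) u k)
lookup-onesFrom> p (false ∷ u) k       = <-trans (n<1+n p) (lookup-onesFrom> (suc p) u k)

lookup-onesFrom≤⇔ : ∀ p (u : Vec Bool n) k t →
                    List.lookup (onesFrom p u) k ≤ p + t ⇔ toℕ k < onesUpTo t u
lookup-onesFrom≤⇔ p u k zero = mk⇔
  (λ q≤p → contradiction (subst (List.lookup (onesFrom p u) k ≤_) (+-identityʳ p) q≤p)
                         (<⇒≱ (lookup-onesFrom> p u k)))
  (λ ())
lookup-onesFrom≤⇔ p (true ∷ u) zero (suc t) = mk⇔
  (λ _ → z<s)
  (λ _ → subst (suc p ≤_) (sym (+-suc p t)) (s≤s (m≤m+n p t)))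
lookup-onesFrom≤⇔ p (true ∷ u) (suc k) (suc t) rewrite +-suc p t = mk⇔
  (λ q≤ → s<s (to (lookup-onesFrom≤⇔ (suc p) u k t) q≤))
  (λ k< → from (lookup-onesFrom≤⇔ (suc p) u k t) (s<s⁻¹ k<))
lookup-onesFrom≤⇔ p (false ∷ u) k (suc t) rewrite +-suc p t = lookup-onesFrom≤⇔ (suc p) u k t

-- π u k is the paper's π_{k+1}(u): the index k : Fin (numOnes u) counts from 0.
π : (u : Word n) → Fin (numOnes u) → ℕ
π u = List.lookup (ones u)

numOnes≡∣∣ : (u : Word n) → numOnes u ≡ ∣ u ∣
numOnes≡∣∣ = length-onesFrom 0

0<π : ∀ (u : Word n) k → 0 < π u k
0<π = lookup-onesFrom> 0

π≤⇔ : ∀ (u : Word n) k t → π u k ≤ t ⇔ toℕ k < onesUpTo t u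
π≤⇔ = lookup-onesFrom≤⇔ 0

≤W⇒≽ : v ≤W w → w ≼ v
≤W⇒≽ {v = v} {w = w} v≤w t = ≮⇒≥ k≮onesUpTo-t-w
  where
  k : ℕ
  k = onesUpTo t v
  -- If w had more than k ones up to t, its (k+1)-th one, hence that of v, would lie
  -- within the first t letters.
  k≮onesUpTo-t-w : ¬ k < onesUpTo t w
  k≮onesUpTo-t-w k< = n≮n k (subst (_< k) (toℕ-fromℕ< k<numOnes)
                        (to (π≤⇔ v i t) (≤-trans (lookup⁺ v≤w i) (from (π≤⇔ w j t) j<))))
    where
    k<numOnes : k < numOnes v
    k<numOnes = <-≤-trans k< (begin
      onesUpTo t w ≤⟨ onesUpTo≤∣∣ t w ⟩
      ∣ w ∣        ≡⟨ sym (numOnes≡∣∣ w) ⟩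
      numOnes w    ≡⟨ sym (Pointwise-length v≤w) ⟩
      numOnes v    ∎)
    i : Fin (numOnes v)
    i = fromℕ< k<numOnes
    j : Fin (numOnes w)
    j = cast (Pointwise-length v≤w) i
    j< : toℕ j < onesUpTo t w
    j< = subst (_< onesUpTo t w) (sym (trans (toℕ-cast _ i) (toℕ-fromℕ< k<numOnes))) k<

≽⇒≤W : w ≼ v → ∣ v ∣ ≡ ∣ w ∣ → v ≤W w
≽⇒≤W {w = w} {v = v} w≼v ∣v∣≡∣w∣ =
  lookup⁻ (trans (numOnes≡∣∣ v) (trans ∣v∣≡∣w∣ (sym (numOnes≡∣∣ w)))) λ {i} {j} i≡j →
    from (π≤⇔ v i (π w j))
      (subst (_< onesUpTo (π w j) v) (sym i≡j)
        (<-≤-trans (to (π≤⇔ w j (π w j)) ≤-refl) (w≼v (π w j))))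

IndepMw? : ∀ r (w : Word n) → Decidable (IndepMw r w)
IndepMw? r w I = (∣ I ∣ ≤? r) ×-dec all? (λ k → ∣ I ∩ initSeg (π w k) ∣ ≤? toℕ k)

IndepMw-⊆ : ∀ r (w : Word n) → J ⊆ I → IndepMw r w I → IndepMw r w J
IndepMw-⊆ {J = J} {I = I} r w J⊆I (∣I∣≤r , I-bounded) =
  ≤-trans (p⊆q⇒∣p∣≤∣q∣ J⊆I) ∣I∣≤r ,
  λ k → begin
    ∣ J ∩ initSeg (π w k) ∣        ≡⟨ ∣∩initSeg∣≡onesUpTo (π w k) J ⟩
    onesUpTo (pred (π w k)) J     ≤⟨ onesUpTo-⊆ (pred (π w k)) J⊆I ⟩
    onesUpTo (pred (π w k)) I     ≡⟨ sym (∣∩initSeg∣≡onesUpTo (π w k) I) ⟩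
    ∣ I ∩ initSeg (π w k) ∣        ≤⟨ I-bounded k ⟩
    toℕ k                         ∎

IndepMw-⊥ : ∀ r (w : Word n) → IndepMw r w ⊥
IndepMw-⊥ {n} r w =
  subst (_≤ r) (sym (∣⊥∣≡0 n)) z≤n ,
  λ k → ≤-trans (∣p∩q∣≤∣p∣ (⊥ {n}) (initSeg (π w k))) (subst (_≤ toℕ k) (sym (∣⊥∣≡0 n)) z≤n)

IndepMw⇒≼ : InW n r w → IndepMw r w I → I ≼ w
IndepMw⇒≼ {w = w} {I = I} inW (∣I∣≤r , I-bounded) t with onesUpTo t w <? numOnes w
... | no ¬lt = begin
  onesUpTo t I ≤⟨ onesUpTo≤∣∣ t I ⟩
  ∣ I ∣         ≤⟨ ∣I∣≤r ⟩
  _             ≡⟨ sym inW ⟩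
  numOnes w    ≤⟨ ≮⇒≥ ¬lt ⟩
  onesUpTo t w ∎
... | yes lt = begin
  onesUpTo t I             ≤⟨ onesUpTo-mono I (<⇒≤pred t<π) ⟩
  onesUpTo (pred (π w k)) I ≡⟨ sym (∣∩initSeg∣≡onesUpTo (π w k) I) ⟩
  ∣ I ∩ initSeg (π w k) ∣   ≤⟨ I-bounded k ⟩
  toℕ k                    ≡⟨ toℕ-fromℕ< lt ⟩
  onesUpTo t w             ∎
  where
  k : Fin (numOnes w)
  k = fromℕ< lt
  t<π : t < π w k
  t<π = ≰⇒> λ π≤t → <-irrefl (toℕ-fromℕ< lt) (to (π≤⇔ w k t) π≤t)

≼⇒IndepMw : InW n r w → I ≼ w → IndepMw r w I
≼⇒IndepMw {n} {w = w} {I = I} inW I≼w = ∣I∣≤r , I-bounded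
  where
  ∣I∣≤r : ∣ I ∣ ≤ _
  ∣I∣≤r = begin
    ∣ I ∣         ≡⟨ sym (onesUpTo-full I ≤-refl) ⟩
    onesUpTo n I ≤⟨ I≼w n ⟩
    onesUpTo n w ≡⟨ onesUpTo-full w ≤-refl ⟩
    ∣ w ∣         ≡⟨ sym (numOnes≡∣∣ w) ⟩
    numOnes w    ≡⟨ inW ⟩
    _            ∎
  ¬π≤pred[π] : ∀ k → ¬ π w k ≤ pred (π w k)
  ¬π≤pred[π] k with π w k | 0<π w k
  ... | suc q | _ = n≮n q
  I-bounded : ∀ k → ∣ I ∩ initSeg (π w k) ∣ ≤ toℕ k
  I-bounded k = begin
    ∣ I ∩ initSeg (π w k) ∣    ≡⟨ ∣∩initSeg∣≡onesUpTo (π w k) I ⟩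
    onesUpTo (pred (π w k)) I ≤⟨ I≼w (pred (π w k)) ⟩
    onesUpTo (pred (π w k)) w ≤⟨ ≮⇒≥ (λ k< → ¬π≤pred[π] k (from (π≤⇔ w k _) k<)) ⟩
    toℕ k                     ∎

∃-greatest : (P : ℕ → Set) → Decidable P → P 0 → ∀ N → (∀ k → P k → k ≤ N) →
             ∃ λ m → P m × (∀ k → P k → k ≤ m)
∃-greatest P P? P0 zero    bound = 0 , P0 , bound
∃-greatest P P? P0 (suc N) bound with P? (suc N)
... | yes PN = suc N , PN , bound
... | no ¬PN = ∃-greatest P P? P0 N λ k Pk →
  s≤s⁻¹ (≤∧≢⇒< (bound k Pk) λ { refl → ¬PN Pk })

induction-upTo : (P : ℕ → Set) → P 0 → (∀ (i : Fin n) → P (toℕ i) → P (suc (toℕ i))) →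
                 ∀ t → t ≤ n → P t
induction-upTo P P0 step zero    _   = P0
induction-upTo {n} P P0 step (suc t) t<n =
  subst (P ∘ suc) (toℕ-fromℕ< t<n)
    (step i (subst P (sym (toℕ-fromℕ< t<n)) (induction-upTo P P0 step t (<⇒≤ t<n))))
  where
  i : Fin n
  i = fromℕ< t<n

∣p∪q∣≤∣p∣+∣q∣ : (p q : Subset n) → ∣ p ∪ q ∣ ≤ ∣ p ∣ + ∣ q ∣
∣p∪q∣≤∣p∣+∣q∣ []          []          = z≤n
∣p∪q∣≤∣p∣+∣q∣ (true  ∷ p) (y     ∷ q) =
  s≤s (≤-trans (∣p∪q∣≤∣p∣+∣q∣ p q) (+-monoʳ-≤ ∣ p ∣ (∣p∣≤∣x∷p∣ y q)))
∣p∪q∣≤∣p∣+∣q∣ (false ∷ p) (true  ∷ q) =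
  subst (suc ∣ p ∪ q ∣ ≤_) (sym (+-suc ∣ p ∣ ∣ q ∣)) (s≤s (∣p∪q∣≤∣p∣+∣q∣ p q))
∣p∪q∣≤∣p∣+∣q∣ (false ∷ p) (false ∷ q) = ∣p∪q∣≤∣p∣+∣q∣ p q

∣p∪⁅x⁆∣≡1+∣p∣ : ∀ {x} (p : Subset n) → x ∉ p → ∣ p ∪ ⁅ x ⁆ ∣ ≡ suc ∣ p ∣
∣p∪⁅x⁆∣≡1+∣p∣ {x = zero}  (false ∷ p) _   = cong (suc ∘ ∣_∣) (∪-identityʳ p)
∣p∪⁅x⁆∣≡1+∣p∣ {x = zero}  (true  ∷ p) x∉p = contradiction here x∉p
∣p∪⁅x⁆∣≡1+∣p∣ {x = suc x} (true  ∷ p) x∉p = cong suc (∣p∪⁅x⁆∣≡1+∣p∣ p (x∉p ∘ there))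
∣p∪⁅x⁆∣≡1+∣p∣ {x = suc x} (false ∷ p) x∉p = ∣p∪⁅x⁆∣≡1+∣p∣ p (x∉p ∘ there)

-- {f_1, ..., f_t} in S_σ; predSet σ i of Defs is prefixSet σ (toℕ i) by definition.
prefixSet : Permutation′ n → ℕ → Subset n
prefixSet σ t = tabulate (λ e → toℕ (σ ⟨$⟩ˡ e) <ᵇ t)

module _ (σ : Permutation′ n) where

  ∈prefixSet⇔ : ∀ {e t} → e ∈ prefixSet σ t ⇔ toℕ (σ ⟨$⟩ˡ e) < t
  ∈prefixSet⇔ {e} {t} = mk⇔
    (λ e∈ → <ᵇ⇒< _ t (from T-≡ (trans (sym (lookup∘tabulate f e)) ([]=⇒lookup e∈))))
    (λ lt → lookup⇒[]= e _ (trans (lookup∘tabulate f e) (to T-≡ (<⇒<ᵇ lt))))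
    where
    f : Fin n → Bool
    f e = toℕ (σ ⟨$⟩ˡ e) <ᵇ t

  σ⟨$⟩ʳi∉prefixSet : ∀ i → σ ⟨$⟩ʳ i ∉ prefixSet σ (toℕ i)
  σ⟨$⟩ʳi∉prefixSet i mem =
    n≮n (toℕ i) (subst (λ j → toℕ j < toℕ i) (inverseˡ σ) (to ∈prefixSet⇔ mem))

  prefixSet-suc : ∀ i → prefixSet σ (suc (toℕ i)) ≡ prefixSet σ (toℕ i) ∪ ⁅ σ ⟨$⟩ʳ i ⁆
  prefixSet-suc i = ⊆-antisym ⊆∪ ∪⊆
    where
    ⊆∪ : prefixSet σ (suc (toℕ i)) ⊆ prefixSet σ (toℕ i) ∪ ⁅ σ ⟨$⟩ʳ i ⁆
    ⊆∪ {e} e∈ with m≤n⇒m<n∨m≡n (s≤s⁻¹ (to ∈prefixSet⇔ e∈))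
    ... | inj₁ lt = x∈p∪q⁺ (inj₁ (from ∈prefixSet⇔ lt))
    ... | inj₂ eq = x∈p∪q⁺ (inj₂ (subst (_∈ ⁅ σ ⟨$⟩ʳ i ⁆) e≡σi (x∈⁅x⁆ _)))
      where
      e≡σi : σ ⟨$⟩ʳ i ≡ e
      e≡σi = trans (cong (σ ⟨$⟩ʳ_) (sym (toℕ-injective eq))) (inverseʳ σ)
    ∪⊆ : prefixSet σ (toℕ i) ∪ ⁅ σ ⟨$⟩ʳ i ⁆ ⊆ prefixSet σ (suc (toℕ i))
    ∪⊆ {e} e∈ with x∈p∪q⁻ _ _ e∈
    ... | inj₁ e∈X = from ∈prefixSet⇔ (m<n⇒m<1+n (to ∈prefixSet⇔ e∈X))
    ... | inj₂ e∈⁅σi⁆ rewrite x∈⁅y⁆⇒x≡y _ e∈⁅σi⁆ =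
      from ∈prefixSet⇔ (subst (λ j → toℕ j < suc (toℕ i)) (sym (inverseˡ σ)) (n<1+n (toℕ i)))

  ∣prefixSet∣ : ∀ t → t ≤ n → ∣ prefixSet σ t ∣ ≡ t
  ∣prefixSet∣ = induction-upTo (λ t → ∣ prefixSet σ t ∣ ≡ t) ∣prefixSet0∣ λ i ∣X∣≡i → begin-equality
    ∣ prefixSet σ (suc (toℕ i)) ∣              ≡⟨ cong ∣_∣ (prefixSet-suc i) ⟩
    ∣ prefixSet σ (toℕ i) ∪ ⁅ σ ⟨$⟩ʳ i ⁆ ∣     ≡⟨ ∣p∪⁅x⁆∣≡1+∣p∣ _ (σ⟨$⟩ʳi∉prefixSet i) ⟩
    suc ∣ prefixSet σ (toℕ i) ∣                ≡⟨ cong suc ∣X∣≡i ⟩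
    suc (toℕ i)                               ∎
    where
    ∣prefixSet0∣ : ∣ prefixSet σ 0 ∣ ≡ 0
    ∣prefixSet0∣ = n≤0⇒n≡0 (≤-trans (p⊆q⇒∣p∣≤∣q∣ prefixSet0⊆⊥) (≤-reflexive (∣⊥∣≡0 n)))
      where
      prefixSet0⊆⊥ : prefixSet σ 0 ⊆ ⊥
      prefixSet0⊆⊥ e∈ = contradiction (to (∈prefixSet⇔ {t = 0}) e∈) λ ()

  prefixSet-n≡⊤ : prefixSet σ n ≡ ⊤
  prefixSet-n≡⊤ = ∣p∣≡n⇒p≡⊤ (∣prefixSet∣ n ≤-refl)

module IndependenceSystem {n} (Ind : Subset n → Set) (Ind? : Decidable Ind)
  (Ind-⊆ : ∀ {I J} → J ⊆ I → Ind I → Ind J) (Ind-⊥ : Ind ⊥) where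

  rank-exists : ∀ X → ∃ (IsRank Ind X)
  rank-exists X with ∃-greatest Indep⊆X-ofSize Indep⊆X-ofSize? (⊥ , ⊆-min X , Ind-⊥ , ∣⊥∣≡0 n) ∣ X ∣ ≤∣X∣
    where
    Indep⊆X-ofSize : ℕ → Set
    Indep⊆X-ofSize k = Σ (Subset n) λ I → I ⊆ X × Ind I × ∣ I ∣ ≡ k
    Indep⊆X-ofSize? : Decidable Indep⊆X-ofSize
    Indep⊆X-ofSize? k = anySubset? λ I → (I ⊆? X) ×-dec (Ind? I ×-dec (∣ I ∣ ≟ k))
    ≤∣X∣ : ∀ k → Indep⊆X-ofSize k → k ≤ ∣ X ∣
    ≤∣X∣ k (I , I⊆X , _ , refl) = p⊆q⇒∣p∣≤∣q∣ I⊆X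
  ... | ρ , witness , greatest = ρ , witness , λ I I⊆X indI → greatest ∣ I ∣ (I , I⊆X , indI , refl)

  rank-unique : ∀ {X a b} → IsRank Ind X a → IsRank Ind X b → a ≡ b
  rank-unique ((I , I⊆X , indI , refl) , a-max) ((J , J⊆X , indJ , refl) , b-max) =
    ≤-antisym (b-max I I⊆X indI) (a-max J J⊆X indJ)

  rank-mono : ∀ {X Y a b} → X ⊆ Y → IsRank Ind X a → IsRank Ind Y b → a ≤ b
  rank-mono X⊆Y ((I , I⊆X , indI , refl) , _) (_ , b-max) = b-max I (⊆-trans I⊆X X⊆Y) indI

  rank-∪⁅⁆≤ : ∀ {X e a b} → IsRank Ind X a → IsRank Ind (X ∪ ⁅ e ⁆) b → b ≤ suc a
  rank-∪⁅⁆≤ {X} {e} {a} (_ , a-max) ((J , J⊆X∪e , indJ , refl) , _) = begin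
    ∣ J ∣                  ≤⟨ p⊆q⇒∣p∣≤∣q∣ J⊆[J∩X]∪e ⟩
    ∣ J ∩ X ∪ ⁅ e ⁆ ∣      ≤⟨ ∣p∪q∣≤∣p∣+∣q∣ (J ∩ X) ⁅ e ⁆ ⟩
    ∣ J ∩ X ∣ + ∣ ⁅ e ⁆ ∣   ≡⟨ cong (∣ J ∩ X ∣ +_) (∣⁅x⁆∣≡1 e) ⟩
    ∣ J ∩ X ∣ + 1          ≤⟨ +-monoˡ-≤ 1 (a-max (J ∩ X) (p∩q⊆q J X) (Ind-⊆ (p∩q⊆p J X) indJ)) ⟩
    a + 1                 ≡⟨ +-comm a 1 ⟩
    suc a                 ∎
    where
    J⊆[J∩X]∪e : J ⊆ J ∩ X ∪ ⁅ e ⁆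
    J⊆[J∩X]∪e x∈J with x∈p∪q⁻ X ⁅ e ⁆ (J⊆X∪e x∈J)
    ... | inj₁ x∈X = x∈p∪q⁺ (inj₁ (x∈p∩q⁺ (x∈J , x∈X)))
    ... | inj₂ x∈e = x∈p∪q⁺ (inj₂ x∈e)

  rank-∣∣≡0 : ∀ {X} → ∣ X ∣ ≡ 0 → IsRank Ind X 0
  rank-∣∣≡0 {X} ∣X∣≡0 = (⊥ , ⊆-min X , Ind-⊥ , ∣⊥∣≡0 n) ,
    λ I I⊆X _ → subst (∣ I ∣ ≤_) ∣X∣≡0 (p⊆q⇒∣p∣≤∣q∣ I⊆X)

  ∈closure⇔rank≡ : ∀ {X e a b} → IsRank Ind X a → IsRank Ind (X ∪ ⁅ e ⁆) b →
                   InClosure Ind X e ⇔ a ≡ b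
  ∈closure⇔rank≡ rankX rankX∪e = mk⇔
    (λ (_ , rankX′ , rankX∪e′) → trans (rank-unique rankX rankX′) (rank-unique rankX∪e′ rankX∪e))
    (λ { refl → _ , rankX , rankX∪e })

  rank-∪⁅⁆-∉closure : ∀ {X e a b} → ¬ InClosure Ind X e →
                      IsRank Ind X a → IsRank Ind (X ∪ ⁅ e ⁆) b → b ≡ suc a
  rank-∪⁅⁆-∉closure e∉cl rankX rankX∪e = ≤-antisym (rank-∪⁅⁆≤ rankX rankX∪e)
    (≤∧≢⇒< (rank-mono (p⊆p∪q _) rankX rankX∪e) (e∉cl ∘ from (∈closure⇔rank≡ rankX rankX∪e)))

  module _ (σ : Permutation′ n) (v : Word n) where

    RecordsPrefixRanks : Set
    RecordsPrefixRanks = ∀ t → t ≤ n → IsRank Ind (prefixSet σ t) (onesUpTo t v)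

    distWord⇒prefixRanks : IsDistWord Ind σ v → RecordsPrefixRanks
    distWord⇒prefixRanks dist = induction-upTo (λ t → IsRank Ind (prefixSet σ t) (onesUpTo t v))
      (rank-∣∣≡0 (∣prefixSet∣ σ 0 z≤n))
      λ i rankX → subst (λ Y → IsRank Ind Y _) (sym (prefixSet-suc σ i)) (step i rankX)
      where
      step : ∀ i → IsRank Ind (prefixSet σ (toℕ i)) (onesUpTo (toℕ i) v) →
             IsRank Ind (prefixSet σ (toℕ i) ∪ ⁅ σ ⟨$⟩ʳ i ⁆) (onesUpTo (suc (toℕ i)) v)
      step i rankX with rank-exists (prefixSet σ (toℕ i) ∪ ⁅ σ ⟨$⟩ʳ i ⁆) | lookup v i in vᵢ | dist i
      ... | b , rankX∪e | false | inCl , _ = subst (IsRank Ind _)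
        (trans (sym (to (∈closure⇔rank≡ rankX rankX∪e) (inCl refl))) (sym (onesUpTo-suc-false v i vᵢ)))
        rankX∪e
      ... | b , rankX∪e | true  | _ , isFalse = subst (IsRank Ind _)
        (trans (rank-∪⁅⁆-∉closure (λ inCl → contradiction (isFalse inCl) λ ()) rankX rankX∪e)
               (sym (onesUpTo-suc-true v i vᵢ)))
        rankX∪e

    private
      ∈closure⇔onesUpTo≡ : RecordsPrefixRanks → ∀ i →
        InClosure Ind (prefixSet σ (toℕ i)) (σ ⟨$⟩ʳ i) ⇔ onesUpTo (toℕ i) v ≡ onesUpTo (suc (toℕ i)) v
      ∈closure⇔onesUpTo≡ ranks i = ∈closure⇔rank≡ (ranks (toℕ i) (<⇒≤ (toℕ<n i)))
        (subst (λ Y → IsRank Ind Y _) (prefixSet-suc σ i) (ranks (suc (toℕ i)) (toℕ<n i)))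

    prefixRanks⇒distWord : RecordsPrefixRanks → IsDistWord Ind σ v
    prefixRanks⇒distWord ranks i with lookup v i in vᵢ
    ... | false = (λ _ → from (∈closure⇔onesUpTo≡ ranks i) (sym (onesUpTo-suc-false v i vᵢ))) , λ _ → refl
    ... | true  = (λ ()) , λ inCl →
      contradiction (sym (trans (to (∈closure⇔onesUpTo≡ ranks i) inCl) (onesUpTo-suc-true v i vᵢ))) 1+n≢n

keepLast : ℕ → Subset n → Subset n
keepLast m []      = []
keepLast m (x ∷ X) with ∣ X ∣ <? m
... | yes _ = x ∷ X
... | no  _ = false ∷ keepLast m X

keepLast-⊆ : ∀ m (X : Subset n) → keepLast m X ⊆ X
keepLast-⊆ m []      = ⊆-refl
keepLast-⊆ m (x ∷ X) with ∣ X ∣ <? m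
... | yes _ = ⊆-refl
... | no  _ = out⊆ (keepLast-⊆ m X)

onesUpTo-keepLast : ∀ t m (X : Subset n) → onesUpTo t (keepLast m X) ≡ onesUpTo t X ∸ (∣ X ∣ ∸ m)
onesUpTo-keepLast zero    m X = sym (0∸n≡0 (∣ X ∣ ∸ m))
onesUpTo-keepLast (suc t) m [] = sym (0∸n≡0 (0 ∸ m))
onesUpTo-keepLast (suc t) m (true ∷ X) with ∣ X ∣ <? m
... | yes ∣X∣<m = sym (cong (suc (onesUpTo t X) ∸_) (m≤n⇒m∸n≡0 ∣X∣<m))
... | no  ∣X∣≮m = trans (onesUpTo-keepLast t m X)
                        (sym (cong (suc (onesUpTo t X) ∸_) (+-∸-assoc 1 (≮⇒≥ ∣X∣≮m))))
onesUpTo-keepLast (suc t) m (false ∷ X) with ∣ X ∣ <? m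
... | yes ∣X∣<m = sym (cong (onesUpTo t X ∸_) (m≤n⇒m∸n≡0 (<⇒≤ ∣X∣<m)))
... | no  _     = onesUpTo-keepLast t m X

∣keepLast∣ : ∀ {m} (X : Subset n) → m ≤ ∣ X ∣ → ∣ keepLast m X ∣ ≡ m
∣keepLast∣ {n} {m} X m≤∣X∣ = begin-equality
  ∣ keepLast m X ∣            ≡⟨ sym (onesUpTo-full (keepLast m X) ≤-refl) ⟩
  onesUpTo n (keepLast m X)  ≡⟨ onesUpTo-keepLast n m X ⟩
  onesUpTo n X ∸ (∣ X ∣ ∸ m)  ≡⟨ cong (_∸ (∣ X ∣ ∸ m)) (onesUpTo-full X ≤-refl) ⟩
  ∣ X ∣ ∸ (∣ X ∣ ∸ m)          ≡⟨ m∸[m∸n]≡n m≤∣X∣ ⟩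
  m                          ∎

keepLast-≼ : ∀ (w X : Subset n) → keepLast (onesUpTo ∣ X ∣ w) X ≼ w
keepLast-≼ w X t = begin
  onesUpTo t (keepLast m X)   ≡⟨ onesUpTo-keepLast t m X ⟩
  onesUpTo t X ∸ (s ∸ m)      ≤⟨ m≤n+o⇒m∸n≤o (onesUpTo t X) (s ∸ m) onesUpTo-t-X≤ ⟩
  onesUpTo t w               ∎
  where
  s m : ℕ
  s = ∣ X ∣
  m = onesUpTo s w
  s≡[s∸m]+m : s ≡ (s ∸ m) + m
  s≡[s∸m]+m = sym (m∸n+n≡m (onesUpTo≤ s w))
  onesUpTo-t-X≤ : onesUpTo t X ≤ (s ∸ m) + onesUpTo t w
  onesUpTo-t-X≤ with t ≤? s
  ... | yes t≤s = ≤-trans (onesUpTo≤ t X) (+-cancelʳ-≤ (s ∸ t) t _ (begin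
    t + (s ∸ t)                           ≡⟨ m+[n∸m]≡n t≤s ⟩
    s                                     ≡⟨ s≡[s∸m]+m ⟩
    (s ∸ m) + m                           ≤⟨ +-monoʳ-≤ (s ∸ m) (onesUpTo-gap t s w) ⟩
    (s ∸ m) + (onesUpTo t w + (s ∸ t))    ≡⟨ sym (+-assoc (s ∸ m) _ (s ∸ t)) ⟩
    (s ∸ m) + onesUpTo t w + (s ∸ t)      ∎))
  ... | no  t≰s = begin
    onesUpTo t X               ≤⟨ onesUpTo≤∣∣ t X ⟩
    s                          ≡⟨ s≡[s∸m]+m ⟩
    (s ∸ m) + m                ≤⟨ +-monoʳ-≤ (s ∸ m) (onesUpTo-mono w (<⇒≤ (≰⇒> t≰s))) ⟩
    (s ∸ m) + onesUpTo t w     ∎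

rank≥onesUpTo : ∀ {ρ} {X : Subset n} → InW n r w → IsRank (IndepMw r w) X ρ → onesUpTo ∣ X ∣ w ≤ ρ
rank≥onesUpTo {w = w} {X = X} inW (_ , ρ-max) =
  subst (_≤ _) (∣keepLast∣ X (onesUpTo≤ ∣ X ∣ w))
    (ρ-max _ (keepLast-⊆ _ X) (≼⇒IndepMw inW (keepLast-≼ w X)))

firstOnesZeros : Vec Bool n → ℕ → ℕ → Subset n
firstOnesZeros []          m       z       = []
firstOnesZeros (true  ∷ w) zero    z       = false ∷ firstOnesZeros w zero z
firstOnesZeros (true  ∷ w) (suc m) z       = true  ∷ firstOnesZeros w m z
firstOnesZeros (false ∷ w) m       zero    = false ∷ firstOnesZeros w m zero
firstOnesZeros (false ∷ w) m       (suc z) = true  ∷ firstOnesZeros w m z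

onesUpTo-firstOnesZeros : ∀ t (w : Vec Bool n) m z →
  onesUpTo t (firstOnesZeros w m z) ≡ m ⊓ onesUpTo t w + z ⊓ onesUpTo t (∁ w)
onesUpTo-firstOnesZeros zero    w           m       z       = sym (cong₂ _+_ (⊓-zeroʳ m) (⊓-zeroʳ z))
onesUpTo-firstOnesZeros (suc t) []          m       z       = sym (cong₂ _+_ (⊓-zeroʳ m) (⊓-zeroʳ z))
onesUpTo-firstOnesZeros (suc t) (true  ∷ w) zero    z       = onesUpTo-firstOnesZeros t w zero z
onesUpTo-firstOnesZeros (suc t) (true  ∷ w) (suc m) z       = cong suc (onesUpTo-firstOnesZeros t w m z)
onesUpTo-firstOnesZeros (suc t) (false ∷ w) m       zero    = onesUpTo-firstOnesZeros t w m zero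
onesUpTo-firstOnesZeros (suc t) (false ∷ w) m       (suc z) =
  trans (cong suc (onesUpTo-firstOnesZeros t w m z)) (sym (+-suc _ _))

firstOnesZeros-⊆ : ∀ (w : Vec Bool n) m z → firstOnesZeros w m 0 ⊆ firstOnesZeros w m z
firstOnesZeros-⊆ []          m       z       = ⊆-refl
firstOnesZeros-⊆ (true  ∷ w) zero    z       = s⊆s (firstOnesZeros-⊆ w zero z)
firstOnesZeros-⊆ (true  ∷ w) (suc m) z       = s⊆s (firstOnesZeros-⊆ w m z)
firstOnesZeros-⊆ (false ∷ w) m       zero    = ⊆-refl
firstOnesZeros-⊆ (false ∷ w) m       (suc z) = out⊆ (firstOnesZeros-⊆ w m z)

firstOnes-≼ : ∀ (w : Vec Bool n) m → firstOnesZeros w m 0 ≼ w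
firstOnes-≼ w m t = begin
  onesUpTo t (firstOnesZeros w m 0)  ≡⟨ onesUpTo-firstOnesZeros t w m 0 ⟩
  m ⊓ onesUpTo t w + 0               ≡⟨ +-identityʳ _ ⟩
  m ⊓ onesUpTo t w                   ≤⟨ m⊓n≤n m _ ⟩
  onesUpTo t w                       ∎

∣firstOnes∣ : ∀ {m} (w : Vec Bool n) → m ≤ ∣ w ∣ → ∣ firstOnesZeros w m 0 ∣ ≡ m
∣firstOnes∣ {n} {m} w m≤∣w∣ = begin-equality
  ∣ firstOnesZeros w m 0 ∣            ≡⟨ sym (onesUpTo-full (firstOnesZeros w m 0) ≤-refl) ⟩
  onesUpTo n (firstOnesZeros w m 0)  ≡⟨ onesUpTo-firstOnesZeros n w m 0 ⟩
  m ⊓ onesUpTo n w + 0               ≡⟨ +-identityʳ _ ⟩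
  m ⊓ onesUpTo n w                   ≡⟨ cong (m ⊓_) (onesUpTo-full w ≤-refl) ⟩
  m ⊓ ∣ w ∣                           ≡⟨ m≤n⇒m⊓n≡m m≤∣w∣ ⟩
  m                                  ∎

-- Up to N the set holds all a ones of w there and z zeros, so after N it holds at most m ∸ a
-- elements, while I ≼ w allows I at most a elements up to N.
⊆firstOnesZeros⇒∣∣≤ : ∀ N {m z} (w I : Subset n) →
  onesUpTo N w ≤ m → z ≤ onesUpTo N (∁ w) → I ⊆ firstOnesZeros w m z → I ≼ w → ∣ I ∣ ≤ m
⊆firstOnesZeros⇒∣∣≤ {n} N {m} {z} w I a≤m z≤b I⊆F I≼w = begin
  ∣ I ∣                          ≡⟨ sym (onesUpTo+onesAfter N I) ⟩
  onesUpTo N I + onesAfter N I  ≤⟨ +-mono-≤ (I≼w N) (onesAfter-⊆ N I⊆F) ⟩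
  a + onesAfter N F             ≤⟨ +-cancelʳ-≤ z _ m a+after+z≤m+z ⟩
  m                             ∎
  where
  F : Subset n
  F = firstOnesZeros w m z
  a : ℕ
  a = onesUpTo N w
  a+after+z≤m+z : a + onesAfter N F + z ≤ m + z
  a+after+z≤m+z = begin
    a + onesAfter N F + z                          ≡⟨ +-assoc a _ z ⟩
    a + (onesAfter N F + z)                        ≡⟨ cong (a +_) (+-comm _ z) ⟩
    a + (z + onesAfter N F)                        ≡⟨ sym (+-assoc a z _) ⟩
    a + z + onesAfter N F                          ≡⟨ cong (_+ onesAfter N F) (sym (cong₂ _+_
                                                        (m≥n⇒m⊓n≡n a≤m) (m≤n⇒m⊓n≡m z≤b))) ⟩
    m ⊓ a + z ⊓ onesUpTo N (∁ w) + onesAfter N F   ≡⟨ cong (_+ onesAfter N F)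
                                                        (sym (onesUpTo-firstOnesZeros N w m z)) ⟩
    onesUpTo N F + onesAfter N F                   ≡⟨ onesUpTo+onesAfter N F ⟩
    ∣ F ∣                                           ≡⟨ sym (onesUpTo-full F ≤-refl) ⟩
    onesUpTo n F                                   ≡⟨ onesUpTo-firstOnesZeros n w m z ⟩
    m ⊓ onesUpTo n w + z ⊓ onesUpTo n (∁ w)        ≤⟨ +-mono-≤ (m⊓n≤m m _) (m⊓n≤m z _) ⟩
    m + z                                          ∎

rank-firstOnesZeros : ∀ N {m z} → InW n r w → m ≤ ∣ w ∣ →
  onesUpTo N w ≤ m → z ≤ onesUpTo N (∁ w) → IsRank (IndepMw r w) (firstOnesZeros w m z) m
rank-firstOnesZeros {w = w} N {m} {z} inW m≤∣w∣ a≤m z≤b =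
  (firstOnesZeros w m 0 , firstOnesZeros-⊆ w m z ,
   ≼⇒IndepMw inW (firstOnes-≼ w m) , ∣firstOnes∣ w m≤∣w∣) ,
  λ I I⊆F indI → ⊆firstOnesZeros⇒∣∣≤ N w I a≤m z≤b I⊆F (IndepMw⇒≼ inW indI)

-- splitBy u i is inj₁ k (inj₂ k) when letter i of u is its k-th one (zero), counting from 0.
splitBy : (u : Vec Bool n) → Fin n → Fin ∣ u ∣ ⊎ Fin ∣ ∁ u ∣
splitBy (true  ∷ u) zero    = inj₁ zero
splitBy (false ∷ u) zero    = inj₂ zero
splitBy (true  ∷ u) (suc i) = Sum.map₁ suc (splitBy u i)
splitBy (false ∷ u) (suc i) = Sum.map₂ suc (splitBy u i)

joinBy : (u : Vec Bool n) → Fin ∣ u ∣ ⊎ Fin ∣ ∁ u ∣ → Fin n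
joinBy (true  ∷ u) (inj₁ zero)    = zero
joinBy (true  ∷ u) (inj₁ (suc k)) = suc (joinBy u (inj₁ k))
joinBy (true  ∷ u) (inj₂ j)       = suc (joinBy u (inj₂ j))
joinBy (false ∷ u) (inj₂ zero)    = zero
joinBy (false ∷ u) (inj₂ (suc j)) = suc (joinBy u (inj₂ j))
joinBy (false ∷ u) (inj₁ k)       = suc (joinBy u (inj₁ k))

joinBy-splitBy : ∀ (u : Vec Bool n) i → joinBy u (splitBy u i) ≡ i
joinBy-splitBy (true  ∷ u) zero    = refl
joinBy-splitBy (false ∷ u) zero    = refl
joinBy-splitBy (true  ∷ u) (suc i) with splitBy u i | joinBy-splitBy u i
... | inj₁ k | eq = cong suc eq
... | inj₂ j | eq = cong suc eq
joinBy-splitBy (false ∷ u) (suc i) with splitBy u i | joinBy-splitBy u i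
... | inj₁ k | eq = cong suc eq
... | inj₂ j | eq = cong suc eq

splitBy-joinBy : ∀ (u : Vec Bool n) c → splitBy u (joinBy u c) ≡ c
splitBy-joinBy (true  ∷ u) (inj₁ zero)    = refl
splitBy-joinBy (true  ∷ u) (inj₁ (suc k)) = cong (Sum.map₁ suc) (splitBy-joinBy u (inj₁ k))
splitBy-joinBy (true  ∷ u) (inj₂ j)       = cong (Sum.map₁ suc) (splitBy-joinBy u (inj₂ j))
splitBy-joinBy (false ∷ u) (inj₂ zero)    = refl
splitBy-joinBy (false ∷ u) (inj₂ (suc j)) = cong (Sum.map₂ suc) (splitBy-joinBy u (inj₂ j))
splitBy-joinBy (false ∷ u) (inj₁ k)       = cong (Sum.map₂ suc) (splitBy-joinBy u (inj₁ k))

splitBy↔ : (u : Vec Bool n) → Fin n ↔ (Fin ∣ u ∣ ⊎ Fin ∣ ∁ u ∣)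
splitBy↔ u = mk↔ₛ′ (splitBy u) (joinBy u) (splitBy-joinBy u) (joinBy-splitBy u)

cast↔ : ∀ {k l} → k ≡ l → Fin k ↔ Fin l
cast↔ eq = mk↔ₛ′ (cast eq) (cast (sym eq)) (cast-involutive eq (sym eq)) (cast-involutive (sym eq) eq)

toℕ-joinBy-inj₁<ᵇ : ∀ (u : Vec Bool n) k t → (toℕ (joinBy u (inj₁ k)) <ᵇ t) ≡ (toℕ k <ᵇ onesUpTo t u)
toℕ-joinBy-inj₁<ᵇ (true  ∷ u) zero    zero    = refl
toℕ-joinBy-inj₁<ᵇ (true  ∷ u) zero    (suc t) = refl
toℕ-joinBy-inj₁<ᵇ (true  ∷ u) (suc k) zero    = refl
toℕ-joinBy-inj₁<ᵇ (true  ∷ u) (suc k) (suc t) = toℕ-joinBy-inj₁<ᵇ u k t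
toℕ-joinBy-inj₁<ᵇ (false ∷ u) k       zero    = refl
toℕ-joinBy-inj₁<ᵇ (false ∷ u) k       (suc t) = toℕ-joinBy-inj₁<ᵇ u k t

toℕ-joinBy-inj₂<ᵇ : ∀ (u : Vec Bool n) j t → (toℕ (joinBy u (inj₂ j)) <ᵇ t) ≡ (toℕ j <ᵇ onesUpTo t (∁ u))
toℕ-joinBy-inj₂<ᵇ (false ∷ u) zero    zero    = refl
toℕ-joinBy-inj₂<ᵇ (false ∷ u) zero    (suc t) = refl
toℕ-joinBy-inj₂<ᵇ (false ∷ u) (suc j) zero    = refl
toℕ-joinBy-inj₂<ᵇ (false ∷ u) (suc j) (suc t) = toℕ-joinBy-inj₂<ᵇ u j t
toℕ-joinBy-inj₂<ᵇ (true  ∷ u) j       zero    = refl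
toℕ-joinBy-inj₂<ᵇ (true  ∷ u) j       (suc t) = toℕ-joinBy-inj₂<ᵇ u j t

lookup-firstOnesZeros : ∀ (w : Vec Bool n) m z e →
  lookup (firstOnesZeros w m z) e ≡ [ (λ k → toℕ k <ᵇ m) , (λ j → toℕ j <ᵇ z) ]′ (splitBy w e)
lookup-firstOnesZeros (true  ∷ w) zero    z       zero    = refl
lookup-firstOnesZeros (true  ∷ w) (suc m) z       zero    = refl
lookup-firstOnesZeros (false ∷ w) m       zero    zero    = refl
lookup-firstOnesZeros (false ∷ w) m       (suc z) zero    = refl
lookup-firstOnesZeros (true  ∷ w) zero    z       (suc e) with splitBy w e | lookup-firstOnesZeros w zero z e
... | inj₁ _ | eq = eq
... | inj₂ _ | eq = eq
lookup-firstOnesZeros (true  ∷ w) (suc m) z       (suc e) with splitBy w e | lookup-firstOnesZeros w m z e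
... | inj₁ _ | eq = eq
... | inj₂ _ | eq = eq
lookup-firstOnesZeros (false ∷ w) m       zero    (suc e) with splitBy w e | lookup-firstOnesZeros w m zero e
... | inj₁ _ | eq = eq
... | inj₂ _ | eq = eq
lookup-firstOnesZeros (false ∷ w) m       (suc z) (suc e) with splitBy w e | lookup-firstOnesZeros w m z e
... | inj₁ _ | eq = eq
... | inj₂ _ | eq = eq

module _ (v w : Word n) (∣v∣≡∣w∣ : ∣ v ∣ ≡ ∣ w ∣) where

  ∣∁v∣≡∣∁w∣ : ∣ ∁ v ∣ ≡ ∣ ∁ w ∣
  ∣∁v∣≡∣∁w∣ = trans (∣∁p∣≡n∸∣p∣ v) (trans (cong (n ∸_) ∣v∣≡∣w∣) (sym (∣∁p∣≡n∸∣p∣ w)))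

  -- sends the k-th one (zero) of v to the k-th one (zero) of w
  matching : Permutation′ n
  matching = ↔-trans (splitBy↔ v) (↔-trans (cast↔ ∣v∣≡∣w∣ ⊎-↔ cast↔ ∣∁v∣≡∣∁w∣) (↔-sym (splitBy↔ w)))

  prefixSet-matching : ∀ t → prefixSet matching t ≡ firstOnesZeros w (onesUpTo t v) (onesUpTo t (∁ v))
  prefixSet-matching t = trans
    (tabulate-cong λ e → trans (position<ᵇt (splitBy w e)) (sym (lookup-firstOnesZeros w _ _ e)))
    (tabulate∘lookup _)
    where
    position<ᵇt : ∀ c →
      (toℕ (joinBy v (Sum.map (cast (sym ∣v∣≡∣w∣)) (cast (sym ∣∁v∣≡∣∁w∣)) c)) <ᵇ t)
        ≡ [ (λ k → toℕ k <ᵇ onesUpTo t v) , (λ j → toℕ j <ᵇ onesUpTo t (∁ v)) ]′ c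
    position<ᵇt (inj₁ k) = trans (toℕ-joinBy-inj₁<ᵇ v _ t) (cong (_<ᵇ onesUpTo t v) (toℕ-cast _ k))
    position<ᵇt (inj₂ j) = trans (toℕ-joinBy-inj₂<ᵇ v _ t) (cong (_<ᵇ onesUpTo t (∁ v)) (toℕ-cast _ j))

module Mw {n} (r : ℕ) (w : Word n) =
  IndependenceSystem (IndepMw r w) (IndepMw? r w) (IndepMw-⊆ r w) (IndepMw-⊥ r w)

distWord⇒≤W : ∀ (w v : Word n) σ → InW n r w → IsDistWord (IndepMw r w) σ v → InW n r v × v ≤W w
distWord⇒≤W {n} {r} w v σ inW dist =
  trans (numOnes≡∣∣ v) ∣v∣≡r , ≽⇒≤W (≼-upTo w≤v) (trans ∣v∣≡r (sym ∣w∣≡r))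
  where
  open Mw r w
  prefixRanks : RecordsPrefixRanks σ v
  prefixRanks = distWord⇒prefixRanks σ v dist
  ∣w∣≡r : ∣ w ∣ ≡ r
  ∣w∣≡r = trans (sym (numOnes≡∣∣ w)) inW
  rank⊤ : IsRank (IndepMw r w) ⊤ r
  rank⊤ = (w , ⊆⊤ , ≼⇒IndepMw {w = w} inW (λ _ → ≤-refl) , ∣w∣≡r) , λ I _ indI → proj₁ indI
  ∣v∣≡r : ∣ v ∣ ≡ r
  ∣v∣≡r = trans (sym (onesUpTo-full v ≤-refl))
    (rank-unique (subst (λ X → IsRank (IndepMw r w) X _) (prefixSet-n≡⊤ σ) (prefixRanks n ≤-refl)) rank⊤)
  w≤v : ∀ t → t ≤ n → onesUpTo t w ≤ onesUpTo t v
  w≤v t t≤n = subst (λ s → onesUpTo s w ≤ _) (∣prefixSet∣ σ t t≤n)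
    (rank≥onesUpTo {w = w} inW (prefixRanks t t≤n))

≤W⇒distWord : ∀ (w v : Word n) → InW n r w → InW n r v → v ≤W w →
              Σ (Permutation′ n) λ σ → IsDistWord (IndepMw r w) σ v
≤W⇒distWord {n} {r} w v inW inV v≤w =
  σ , prefixRanks⇒distWord σ v λ t t≤n →
    subst (λ X → IsRank (IndepMw r w) X _) (sym (prefixSet-matching v w ∣v∣≡∣w∣ t))
      (rank-firstOnesZeros {w = w} t inW
        (≤-trans (onesUpTo≤∣∣ t v) (≤-reflexive ∣v∣≡∣w∣))
        (≤W⇒≽ v≤w t)
        (onesUpTo∁-antitone w v t≤n (≤W⇒≽ v≤w t)))
  where
  open Mw r w
  ∣v∣≡∣w∣ : ∣ v ∣ ≡ ∣ w ∣
  ∣v∣≡∣w∣ = trans (sym (numOnes≡∣∣ v)) (trans inV (trans (sym inW) (numOnes≡∣∣ w)))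
  σ : Permutation′ n
  σ = matching v w ∣v∣≡∣w∣

theorem7p5 : (n r : ℕ) (w : Word n) → InW n r w →
    (v : Word n) →
      ((Σ (Permutation′ n) λ σ → IsDistWord (IndepMw r w) σ v) → (InW n r v × v ≤W w))
      × ((InW n r v × v ≤W w) → Σ (Permutation′ n) λ σ → IsDistWord (IndepMw r w) σ v)
theorem7p5 n r w inW v =
  (λ (σ , dist) → distWord⇒≤W w v σ inW dist) ,
  (λ (inV , v≤w) → ≤W⇒distWord w v inW inV v≤w)
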